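{- For $n\ge1$ let $\overline{\overline{G}}_n:=\prod_{k=0}^n\binom{n}{k}_{\mathbb{Z},\mathbb{N}}$. Then $$\overline{\overline{G}}_n=\prod_{b=2}^n b^{\overline{\nu}(n,b)},\qquad \overline{\nu}(n,b):=\frac{2}{b-1}S_b(n)-\frac{n-1}{b-1}d_b(n),$$ where $d_b(j)$ is the sum of the base-$b$ digits of $j$ and $S_b(n):=\sum_{j=1}^{n-1}d_b(j)$.
   Context: For integers $b\ge0$ and $a\in\mathbb{Z}$ let $\operatorname{ord}_b(a):=\sup\{k\in\mathbb{N}: a\mathbb{Z}\subseteq b^k\mathbb{Z}\}$ (convention $0^0=1$); for $b\ge2$ this is the largest $k$ with $b^k\mid a$; $\operatorname{ord}_1\equiv+\infty$; $\operatorname{ord}_0(a)=0$ for $a\ne0$, $\operatorname{ord}_0(0)=+\infty$. For nonempty $S\subseteq\mathbb{Z}$, a $b$-ordering of $S$ is an infinite sequence $(a_i)_{i\ge0}$ in $S$ such that for every $i\ge1$, $\sum_{j<i}\operatorname{ord}_b(a_i-a_j)=\min_{a'\in S}\sum_{j<i}\operatorname{ord}_b(a'-a_j)$. The quantity $\alpha_k(S,b):=\sum_{j<k}\operatorname{ord}_b(a_k-a_j)$ (with $\alpha_0=0$) does not depend on the choice of $b$-ordering. For $\mathcal{T}\subseteq\mathbb{N}$, $k!_{S,\mathcal{T}}:=\prod_{b\in\mathcal{T}}b^{\alpha_k(S,b)}$ (conventions $b^{+\infty}=0$ for $b\ge2$ and $b=0$, $1^{+\infty}=1$, $b^0=1$),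 and $\binom{k}{\ell}_{S,\mathcal{T}}:=\dfrac{k!_{S,\mathcal{T}}}{\ell!_{S,\mathcal{T}}(k-\ell)!_{S,\mathcal{T}}}$. -}

module Defs where

open import Data.Nat as ℕ using (ℕ; zero; suc; _∸_; NonZero)
open import Data.Nat.Divisibility using (_∣?_)
open import Data.Nat.DivMod using (_/_; _%_)
open import Data.Nat.Properties using (_≟_)
open import Data.Integer as ℤ using (ℤ; +_; -[1+_]; ∣_∣)
open import Data.Rational as ℚ using (ℚ)
open import Data.List using (List; []; _∷_; upTo; map; foldr)
open import Data.Product using (Σ; _×_; ∃)
open import Relation.Nullary using (yes; no)
open import Relation.Binary.PropositionalEquality using (_≡_)

data ℕ∞ : Set where
  fin : ℕ → ℕ∞
  ∞   : ℕ∞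

infixl 6 _+∞_
_+∞_ : ℕ∞ → ℕ∞ → ℕ∞
fin m +∞ fin n = fin (m ℕ.+ n)
fin _ +∞ ∞     = ∞
∞     +∞ _     = ∞

infix 4 _≤∞_
data _≤∞_ : ℕ∞ → ℕ∞ → Set where
  fin≤fin : ∀ {m n} → m ℕ.≤ n → fin m ≤∞ fin n
  _≤∞∞    : ∀ x → x ≤∞ ∞

-- ord_b(a) = sup { k ∈ ℕ : a ℤ ⊆ b^k ℤ }  (i.e. sup { k : b^k ∣ a },
-- with 0^0 = 1).
--   b = 0 : ord_0(0) = ∞, ord_0(a) = 0 for a ≠ 0
--   b = 1 : ord_1 ≡ ∞
--   b ≥ 2 : ord_b(0) = ∞, and for a ≠ 0 the largest k with b^k ∣ a.
-- For b ≥ 2 and a ≠ 0, any k with b^k ∣ a satisfies k < b^k ≤ |a|, so the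
-- largest such k is found by searching k = |a|, |a|-1, …, 0.

largestPow : ℕ → ℕ → ℕ → ℕ
largestPow b m zero    = zero
largestPow b m (suc k) with (b ℕ.^ suc k) ∣? m
... | yes _ = suc k
... | no  _ = largestPow b m k

ord : ℕ → ℤ → ℕ∞
ord zero          (+ zero) = ∞
ord zero          _        = fin 0
ord (suc zero)    _        = ∞
ord (suc (suc b)) (+ zero) = ∞
ord b@(suc (suc _)) a      = fin (largestPow b ∣ a ∣ ∣ a ∣)

sumOrd : ℕ → (ℕ → ℤ) → ℕ → ℤ → ℕ∞
sumOrd b a zero    x = fin 0
sumOrd b a (suc i) x = sumOrd b a i x +∞ ord b (x ℤ.- a i)

-- (a_i) is a b-ordering of ℤ: for every i ≥ 1 the value at a_i is the
-- minimum over a' ∈ ℤ (a_i ∈ ℤ attains it, so "= min" is "≤ every value").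
IsBOrdering : ℕ → (ℕ → ℤ) → Set
IsBOrdering b a = ∀ i → 1 ℕ.≤ i → ∀ (a' : ℤ) → sumOrd b a i (a i) ≤∞ sumOrd b a i a'

α : ℕ → (ℕ → ℤ) → ℕ → ℕ∞
α b a k = sumOrd b a k (a k)

pow∞ : ℕ → ℕ∞ → ℕ
pow∞ b           (fin e) = b ℕ.^ e
pow∞ (suc zero)  ∞       = 1
pow∞ _           ∞       = 0

prodBelow : ℕ → (ℕ → ℕ) → ℕ
prodBelow B f = foldr ℕ._*_ 1 (map f (upTo B))

InfProd≡ : (ℕ → ℕ) → ℕ → Set
InfProd≡ f v = Σ ℕ λ B → (∀ b → B ℕ.≤ b → f b ≡ 1) × (prodBelow B f ≡ v)

IsFactorial : (ℕ → ℕ → ℤ) → ℕ → ℕ → Set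
IsFactorial σ k v = InfProd≡ (λ b → pow∞ b (α b (σ b) k)) v

-- m / d in ℚ  (only used with d ≠ 0; d = 0 gives 0 by convention)
divℚ : ℕ → ℕ → ℚ
divℚ m zero    = ℚ.0ℚ
divℚ m (suc d) = (+ m) ℚ./ suc d

binomℚ : (ℕ → ℕ) → ℕ → ℕ → ℚ
binomℚ fact k l = divℚ (fact k) (fact l ℕ.* fact (k ∸ l))

prodℚ : List ℚ → ℚ
prodℚ = foldr ℚ._*_ ℚ.1ℚ

-- b^e for b ∈ ℕ, e ∈ ℤ, as a rational (b = 0 with e < 0 gives 0; unused)
powℤ : ℕ → ℤ → ℚ
powℤ b       (+ n)    = (+ (b ℕ.^ n)) ℚ./ 1
powℤ zero    -[1+ n ] = ℚ.0ℚ
powℤ (suc b) -[1+ n ] = divℚ 1 (suc b ℕ.^ suc n)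

Gbar : (ℕ → ℕ) → ℕ → ℚ
Gbar fact n = prodℚ (map (binomℚ fact n) (upTo (suc n)))

-- base-b digit sums (b ≥ 2): d_b(j) = (j mod b) + d_b(⌊j/b⌋), d_b(0) = 0.
-- The fuel argument f ≥ j suffices since ⌊j/b⌋ < j for j ≥ 1.

digitSumAux : (b : ℕ) .{{_ : NonZero b}} → ℕ → ℕ → ℕ
digitSumAux b zero    j = 0
digitSumAux b (suc f) j = j % b ℕ.+ digitSumAux b f (j / b)

-- d_b(j); defined as 0 for b ∈ {0,1} (never used)
digitSum : ℕ → ℕ → ℕ
digitSum zero          j = 0
digitSum (suc zero)    j = 0
digitSum b@(suc (suc _)) j = digitSumAux b j j

S : ℕ → ℕ → ℕ
S b n = foldr ℕ._+_ 0 (map (digitSum b) (upTo n))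

{-# OPTIONS --safe #-}
-- For b ≥ 2, ord_b(x − a_j) = Σ_{e ≥ 1} [b^e ∣ x − a_j], so Σ_{j<i} ord_b(x − a_j) counts, for every
-- e ≥ 1, the a_j (j < i) in the residue class of x modulo b^e. For a b-ordering, by induction on i,
-- the counts over the classes modulo each b^e differ by at most one, so the least count is ⌊i/b^e⌋;
-- refining classes level by level yields a point x whose class is least populated modulo every b^e.
-- The b-ordering property forces a_i to do as well as x, hence to lie in least populated classes
-- itself (which keeps the counts balanced), and α_i(ℤ,b) = Σ_{e ≥ 1} ⌊i/b^e⌋. Legendre's identity
-- (b − 1) Σ_{e ≥ 1} ⌊k/b^e⌋ = k − d_b(k) turns the exponent of b in binom(n,k) into
-- (d_b(k) + d_b(n − k) − d_b(n))/(b − 1), and summing over k gives ν̄(n,b). The bases b = 0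
-- (where α = 0) and b = 1 (where 1^α = 1) contribute nothing.
module Submission where

open import Defs
open import Algebra.Structures using (IsCommutativeMonoid)
import Data.Nat
open import Data.Nat as ℕ using (ℕ; zero; suc; z≤n; s≤s; z<s; s<s; _≤_; _<_; _^_; _∸_; NonZero)
open import Data.Nat.Properties as ℕP using (+-0-isCommutativeMonoid; *-1-isCommutativeMonoid)
open import Data.Nat.DivMod using (_/_; _%_)
import Data.Nat.DivMod as ℕ/
import Data.Nat.Tactic.RingSolver as ℕ-Ring
open import Data.Nat.Divisibility as ℕ∣ using () renaming (_∣?_ to _∣ₙ?_)
open import Data.Integer using (ℤ; +_; -[1+_]; ∣_∣; _+_; _-_; _*_)
import Data.Integer.Properties as ℤP
import Data.Integer.Tactic.RingSolver as ℤ-Ring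
open import Data.Integer.Divisibility.Signed as ℤ∣ using (_∣_; _∣?_; divides; ∣ᵤ⇒∣; ∣⇒∣ᵤ)
open import Data.Rational as ℚ using (ℚ)
import Data.Rational.Properties as ℚP
open import Data.Rational.Unnormalised using (mkℚᵘ; *≡*)
import Data.Rational.Unnormalised.Properties as ℚᵘP
open import Data.List using (map; foldr; applyUpTo; upTo)
open import Data.Product using (Σ; _×_; _,_)
open import Function using (_∘_; id)
open import Relation.Binary.PropositionalEquality
open import Relation.Nullary using (¬_; yes; no; Dec)
open import Data.Empty using (⊥-elim)

module BigOperator {A : Set} {_∙_ : A → A → A} {ε : A}
                   (isCM : IsCommutativeMonoid _≡_ _∙_ ε) where

  open IsCommutativeMonoid isCM using (assoc; comm; identityˡ; identityʳ)
  open ≡-Reasoning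

  ⨁ : ℕ → (ℕ → A) → A
  ⨁ zero    f = ε
  ⨁ (suc n) f = f 0 ∙ ⨁ n (f ∘ suc)

  ⨁-cong : ∀ n {f g} → (∀ k → k < n → f k ≡ g k) → ⨁ n f ≡ ⨁ n g
  ⨁-cong zero    f≡g = refl
  ⨁-cong (suc n) f≡g = cong₂ _∙_ (f≡g 0 z<s) (⨁-cong n (λ k k<n → f≡g (suc k) (s<s k<n)))

  ⨁-identity : ∀ n {f} → (∀ k → k < n → f k ≡ ε) → ⨁ n f ≡ ε
  ⨁-identity zero    f≡ε = refl
  ⨁-identity (suc n) f≡ε = begin
    _ ∙ _ ≡⟨ cong₂ _∙_ (f≡ε 0 z<s) (⨁-identity n (λ k k<n → f≡ε (suc k) (s<s k<n))) ⟩
    ε ∙ ε ≡⟨ identityˡ ε ⟩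
    ε     ∎

  ⨁-split : ∀ m j f → ⨁ (m ℕ.+ j) f ≡ ⨁ m f ∙ ⨁ j (λ t → f (m ℕ.+ t))
  ⨁-split zero    j f = sym (identityˡ _)
  ⨁-split (suc m) j f = trans (cong (f 0 ∙_) (⨁-split m j (f ∘ suc))) (sym (assoc _ _ _))

  ⨁-last : ∀ n f → ⨁ (suc n) f ≡ ⨁ n f ∙ f n
  ⨁-last n f = begin
    ⨁ (suc n) f                 ≡⟨ cong (λ m → ⨁ m f) (ℕP.+-comm 1 n) ⟩
    ⨁ (n ℕ.+ 1) f               ≡⟨ ⨁-split n 1 f ⟩
    ⨁ n f ∙ (f (n ℕ.+ 0) ∙ ε)   ≡⟨ cong (⨁ n f ∙_) (trans (identityʳ _) (cong f (ℕP.+-identityʳ n))) ⟩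
    ⨁ n f ∙ f n                 ∎

  ⨁-extend : ∀ {m N} f → m ≤ N → (∀ k → m ≤ k → k < N → f k ≡ ε) → ⨁ N f ≡ ⨁ m f
  ⨁-extend {m} {N} f m≤N tail≡ε = begin
    ⨁ N f                                 ≡⟨ cong (λ n → ⨁ n f) (sym (ℕP.m+[n∸m]≡n m≤N)) ⟩
    ⨁ (m ℕ.+ (N ∸ m)) f                   ≡⟨ ⨁-split m (N ∸ m) f ⟩
    ⨁ m f ∙ ⨁ (N ∸ m) (λ t → f (m ℕ.+ t))  ≡⟨ cong (⨁ m f ∙_) (⨁-identity (N ∸ m) tail) ⟩
    ⨁ m f ∙ ε                             ≡⟨ identityʳ _ ⟩
    ⨁ m f                                 ∎
    where
    tail : ∀ t → t < N ∸ m → f (m ℕ.+ t) ≡ ε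
    tail t t<N∸m = tail≡ε (m ℕ.+ t) (ℕP.m≤m+n m t)
                     (subst (m ℕ.+ t <_) (ℕP.m+[n∸m]≡n m≤N) (ℕP.+-monoʳ-< m t<N∸m))

  ⨁-distrib : ∀ n f g → ⨁ n (λ k → f k ∙ g k) ≡ ⨁ n f ∙ ⨁ n g
  ⨁-distrib zero    f g = sym (identityˡ ε)
  ⨁-distrib (suc n) f g = begin
    (f 0 ∙ g 0) ∙ ⨁ n (λ k → f (suc k) ∙ g (suc k))  ≡⟨ cong ((f 0 ∙ g 0) ∙_) (⨁-distrib n (f ∘ suc) (g ∘ suc)) ⟩
    (f 0 ∙ g 0) ∙ (F ∙ G)                           ≡⟨ assoc (f 0) (g 0) (F ∙ G) ⟩
    f 0 ∙ (g 0 ∙ (F ∙ G))                           ≡⟨ cong (f 0 ∙_) (sym (assoc (g 0) F G)) ⟩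
    f 0 ∙ ((g 0 ∙ F) ∙ G)                           ≡⟨ cong (λ x → f 0 ∙ (x ∙ G)) (comm (g 0) F) ⟩
    f 0 ∙ ((F ∙ g 0) ∙ G)                           ≡⟨ cong (f 0 ∙_) (assoc F (g 0) G) ⟩
    f 0 ∙ (F ∙ (g 0 ∙ G))                           ≡⟨ sym (assoc (f 0) F (g 0 ∙ G)) ⟩
    (f 0 ∙ F) ∙ (g 0 ∙ G)                           ∎
    where
    F = ⨁ n (f ∘ suc)
    G = ⨁ n (g ∘ suc)

  ⨁-comm : ∀ n m (h : ℕ → ℕ → A) → ⨁ n (λ i → ⨁ m (h i)) ≡ ⨁ m (λ j → ⨁ n (λ i → h i j))
  ⨁-comm zero    m h = sym (⨁-identity m (λ _ _ → refl))
  ⨁-comm (suc n) m h = begin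
    ⨁ m (h 0) ∙ ⨁ n (λ i → ⨁ m (h (suc i)))        ≡⟨ cong (⨁ m (h 0) ∙_) (⨁-comm n m (h ∘ suc)) ⟩
    ⨁ m (h 0) ∙ ⨁ m (λ j → ⨁ n (λ i → h (suc i) j)) ≡⟨ sym (⨁-distrib m (h 0) _) ⟩
    ⨁ m (λ j → h 0 j ∙ ⨁ n (λ i → h (suc i) j))    ∎

  foldr-map-applyUpTo : ∀ {B : Set} n (f : B → A) (g : ℕ → B) → foldr _∙_ ε (map f (applyUpTo g n)) ≡ ⨁ n (f ∘ g)
  foldr-map-applyUpTo zero    f g = refl
  foldr-map-applyUpTo (suc n) f g = cong (f (g 0) ∙_) (foldr-map-applyUpTo n f (g ∘ suc))

open BigOperator +-0-isCommutativeMonoid using ()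
  renaming ( ⨁ to ∑; ⨁-cong to ∑-cong; ⨁-identity to ∑-zero; ⨁-last to ∑-last; ⨁-extend to ∑-extend
           ; ⨁-distrib to ∑-distrib-+; ⨁-comm to ∑-comm; foldr-map-applyUpTo to foldr-+-map-applyUpTo)
open BigOperator *-1-isCommutativeMonoid using ()
  renaming ( ⨁ to ∏; ⨁-cong to ∏-cong; ⨁-extend to ∏-extend; ⨁-distrib to ∏-distrib-*
           ; ⨁-comm to ∏-comm; foldr-map-applyUpTo to foldr-*-map-applyUpTo)

module _ where
  open ℕP
  open ≡-Reasoning

  ∑-const : ∀ n c → ∑ n (λ _ → c) ≡ n ℕ.* c
  ∑-const zero    c = refl
  ∑-const (suc n) c = cong (c ℕ.+_) (∑-const n c)

  ∑-*ˡ : ∀ n c f → ∑ n (λ k → c ℕ.* f k) ≡ c ℕ.* ∑ n f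
  ∑-*ˡ zero    c f = sym (*-zeroʳ c)
  ∑-*ˡ (suc n) c f = trans (cong (c ℕ.* f 0 ℕ.+_) (∑-*ˡ n c (f ∘ suc))) (sym (*-distribˡ-+ c (f 0) _))

  ∑-reverse : ∀ n f → ∑ (suc n) (λ k → f (n ∸ k)) ≡ ∑ (suc n) f
  ∑-reverse zero    f = refl
  ∑-reverse (suc n) f = begin
    ∑ (suc (suc n)) (λ k → f (suc n ∸ k))            ≡⟨ ∑-last (suc n) (λ k → f (suc n ∸ k)) ⟩
    ∑ (suc n) (λ k → f (suc n ∸ k)) ℕ.+ f (suc n ∸ suc n)
      ≡⟨ cong₂ ℕ._+_ (∑-cong (suc n) (λ k k<1+n → cong f (+-∸-assoc 1 (ℕ.s≤s⁻¹ k<1+n)))) (cong f (n∸n≡0 n)) ⟩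
    ∑ (suc n) (λ k → f (suc (n ∸ k))) ℕ.+ f 0        ≡⟨ cong (ℕ._+ f 0) (∑-reverse n (f ∘ suc)) ⟩
    ∑ (suc n) (f ∘ suc) ℕ.+ f 0                      ≡⟨ +-comm _ (f 0) ⟩
    ∑ (suc (suc n)) f                                ∎

  ∑-mono-≤ : ∀ n {f g} → (∀ k → k < n → f k ≤ g k) → ∑ n f ≤ ∑ n g
  ∑-mono-≤ zero    f≤g = z≤n
  ∑-mono-≤ (suc n) f≤g = +-mono-≤ (f≤g 0 z<s) (∑-mono-≤ n (λ k k<n → f≤g (suc k) (s<s k<n)))

  term≤∑ : ∀ n f {k} → k < n → f k ≤ ∑ n f
  term≤∑ (suc n) f {zero}  _         = m≤m+n (f 0) _
  term≤∑ (suc n) f {suc k} (s<s k<n) = ≤-trans (term≤∑ n (f ∘ suc) k<n) (m≤n+m _ (f 0))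

  ∑-mono-≤-tight : ∀ n {f g} → (∀ k → k < n → f k ≤ g k) → ∑ n g ≤ ∑ n f → ∀ k → k < n → f k ≡ g k
  ∑-mono-≤-tight (suc n) {f} {g} f≤g ∑g≤∑f zero _ =
    ≤-antisym (f≤g 0 z<s)
      (+-cancelʳ-≤ (∑ n (f ∘ suc)) (g 0) (f 0)
        (≤-trans (+-monoʳ-≤ (g 0) (∑-mono-≤ n (λ k k<n → f≤g (suc k) (s<s k<n)))) ∑g≤∑f))
  ∑-mono-≤-tight (suc n) {f} {g} f≤g ∑g≤∑f (suc k) (s<s k<n) =
    ∑-mono-≤-tight n (λ k k<n → f≤g (suc k) (s<s k<n))
      (+-cancelˡ-≤ (g 0) _ _ (≤-trans ∑g≤∑f (+-monoˡ-≤ (∑ n (f ∘ suc)) (f≤g 0 z<s)))) k k<n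

  ∑-<-deficient : ∀ n f {M s} → (∀ k → k < n → f k ≤ M) → s < n → f s < M → ∑ n f < n ℕ.* M
  ∑-<-deficient (suc n) f {M} {zero}  f≤M _ fs<M =
    +-mono-<-≤ fs<M (≤-trans (∑-mono-≤ n (λ k k<n → f≤M (suc k) (s<s k<n))) (≤-reflexive (∑-const n M)))
  ∑-<-deficient (suc n) f {M} {suc s} f≤M (s<s s<n) fs<M =
    +-mono-≤-< (f≤M 0 z<s) (∑-<-deficient n (f ∘ suc) (λ k k<n → f≤M (suc k) (s<s k<n)) s<n fs<M)

  ∃-term≤average : ∀ n f → 1 ≤ n → Σ ℕ λ t → t < n × n ℕ.* f t ≤ ∑ n f
  ∃-term≤average (suc zero)    f _ = 0 , z<s , ≤-refl
  ∃-term≤average (suc (suc n)) f _ with ∃-term≤average (suc n) (f ∘ suc) (s≤s z≤n)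
  ... | t , t<n , avg with f 0 ≤? f (suc t)
  ...   | yes f0≤ = 0 , z<s , +-monoʳ-≤ (f 0) (≤-trans (*-monoʳ-≤ (suc n) f0≤) avg)
  ...   | no f0≰ = suc t , s<s t<n , +-mono-≤ (<⇒≤ (≰⇒> f0≰)) avg

  ∏-pow : ∀ n b e → ∏ n (λ k → b ^ e k) ≡ b ^ ∑ n e
  ∏-pow zero    b e = refl
  ∏-pow (suc n) b e = trans (cong (b ^ e 0 ℕ.*_) (∏-pow n b (e ∘ suc))) (sym (^-distribˡ-+-* b (e 0) _))

  ∏-pos : ∀ n f → (∀ k → k < n → 0 < f k) → 0 < ∏ n f
  ∏-pos zero    f _   = z<s
  ∏-pos (suc n) f f>0 = *-mono-≤ (f>0 0 z<s) (∏-pos n (f ∘ suc) (λ k k<n → f>0 (suc k) (s<s k<n)))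

𝟙 : ∀ {p} {P : Set p} → Dec P → ℕ
𝟙 (yes _) = 1
𝟙 (no _)  = 0

module _ {p} {P : Set p} where

  𝟙-yes : (P? : Dec P) → P → 𝟙 P? ≡ 1
  𝟙-yes (yes _) _ = refl
  𝟙-yes (no ¬p) p = ⊥-elim (¬p p)

  𝟙-no : (P? : Dec P) → ¬ P → 𝟙 P? ≡ 0
  𝟙-no (yes p) ¬p = ⊥-elim (¬p p)
  𝟙-no (no _)  _  = refl

module _ {p q} {P : Set p} {Q : Set q} where

  𝟙-mono : (P? : Dec P) (Q? : Dec Q) → (P → Q) → 𝟙 P? ≤ 𝟙 Q?
  𝟙-mono (no _)  _       _   = z≤n
  𝟙-mono (yes _) (yes _) _   = ℕP.≤-refl
  𝟙-mono (yes p) (no ¬q) P⇒Q = ⊥-elim (¬q (P⇒Q p))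

  𝟙-cong : (P? : Dec P) (Q? : Dec Q) → (P → Q) → (Q → P) → 𝟙 P? ≡ 𝟙 Q?
  𝟙-cong (yes p) Q? P⇒Q _   = sym (𝟙-yes Q? (P⇒Q p))
  𝟙-cong (no ¬p) Q? _   Q⇒P = sym (𝟙-no Q? (¬p ∘ Q⇒P))

∑-window-periodic : ∀ q (f : ℤ → ℕ) → (∀ y → f (y + + q) ≡ f y) →
                    ∀ z → ∑ q (λ t → f (z + + t)) ≡ ∑ q (λ t → f (+ t))
∑-window-periodic zero       f periodic z = refl
∑-window-periodic q@(suc q′) f periodic = window-const
  where
  open ≡-Reasoning
  window : ℤ → ℕ
  window z = ∑ q (λ t → f (z + + t))

  window-step : ∀ z → window (z + + 1) ≡ window z
  window-step z = begin
    ∑ q (λ t → f (z + + 1 + + t))                 ≡⟨ ∑-cong q (λ t _ → cong f (ℤP.+-assoc z (+ 1) (+ t))) ⟩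
    ∑ q (λ t → f (z + + suc t))                   ≡⟨ ∑-last q′ (λ t → f (z + + suc t)) ⟩
    ∑ q′ (λ t → f (z + + suc t)) ℕ.+ f (z + + q)  ≡⟨ cong (∑ q′ (λ t → f (z + + suc t)) ℕ.+_) wrap ⟩
    ∑ q′ (λ t → f (z + + suc t)) ℕ.+ f (z + + 0)  ≡⟨ ℕP.+-comm _ (f (z + + 0)) ⟩
    window z                                      ∎
    where
    wrap : f (z + + q) ≡ f (z + + 0)
    wrap = trans (periodic z) (cong f (sym (ℤP.+-identityʳ z)))

  window-+ : ∀ z n → window (z + + n) ≡ window z
  window-+ z zero    = cong window (ℤP.+-identityʳ z)
  window-+ z (suc n) = begin
    window (z + + suc n)    ≡⟨ cong window (sym (trans (ℤP.+-assoc z (+ n) (+ 1)) (cong (λ m → z + + m) (ℕP.+-comm n 1)))) ⟩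
    window (z + + n + + 1)  ≡⟨ window-step (z + + n) ⟩
    window (z + + n)        ≡⟨ window-+ z n ⟩
    window z                ∎

  window-const : ∀ z → window z ≡ window (+ 0)
  window-const (+ n)    = window-+ (+ 0) n
  window-const -[1+ n ] = trans (sym (window-+ -[1+ n ] (suc n))) (cong window (ℤP.+-inverseˡ (+ suc n)))

⟦_∣_⟧ : ℕ → ℤ → ℕ
⟦ q ∣ y ⟧ = 𝟙 (+ q ∣? y)

⟦∣⟧-yes : ∀ {q y} → + q ∣ y → ⟦ q ∣ y ⟧ ≡ 1
⟦∣⟧-yes {q} {y} = 𝟙-yes (+ q ∣? y)

⟦∣⟧-no : ∀ {q y} → ¬ (+ q ∣ y) → ⟦ q ∣ y ⟧ ≡ 0
⟦∣⟧-no {q} {y} = 𝟙-no (+ q ∣? y)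

⟦∣⟧-mono : ∀ {q r y z} → (+ q ∣ y → + r ∣ z) → ⟦ q ∣ y ⟧ ≤ ⟦ r ∣ z ⟧
⟦∣⟧-mono {q} {r} {y} {z} = 𝟙-mono (+ q ∣? y) (+ r ∣? z)

⟦∣⟧-cong : ∀ {q r y z} → (+ q ∣ y → + r ∣ z) → (+ r ∣ z → + q ∣ y) → ⟦ q ∣ y ⟧ ≡ ⟦ r ∣ z ⟧
⟦∣⟧-cong {q} {r} {y} {z} = 𝟙-cong (+ q ∣? y) (+ r ∣? z)

⟦∣⟧-periodic : ∀ q y → ⟦ q ∣ y + + q ⟧ ≡ ⟦ q ∣ y ⟧
⟦∣⟧-periodic q y = ⟦∣⟧-cong (λ d → ℤ∣.∣m+n∣n⇒∣m d ℤ∣.∣-refl) (λ d → ℤ∣.∣m∣n⇒∣m+n d ℤ∣.∣-refl)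

∑-⟦∣⟧-window : ∀ q .{{_ : NonZero q}} z → ∑ q (λ t → ⟦ q ∣ z + + t ⟧) ≡ 1
∑-⟦∣⟧-window q@(suc q′) z = begin
  ∑ q (λ t → ⟦ q ∣ z + + t ⟧)       ≡⟨ ∑-window-periodic q (λ y → ⟦ q ∣ y ⟧) (⟦∣⟧-periodic q) z ⟩
  ⟦ q ∣ + 0 ⟧ ℕ.+ ∑ q′ (λ t → ⟦ q ∣ + suc t ⟧)
    ≡⟨ cong₂ ℕ._+_ (⟦∣⟧-yes {q} (divides (+ 0) refl)) (∑-zero q′ (λ t t<q′ → ⟦∣⟧-no (q∤1+t t<q′))) ⟩
  1                                 ∎
  where
  open ≡-Reasoning
  q∤1+t : ∀ {t} → t < q′ → ¬ (+ q ∣ + suc t)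
  q∤1+t t<q′ q∣1+t = ℕP.<⇒≱ (s<s t<q′) (ℕ∣.∣⇒≤ (∣⇒∣ᵤ q∣1+t))

∑-⟦∣⟧-refine : ∀ b q .{{_ : NonZero b}} .{{_ : NonZero q}} y →
               ∑ b (λ t → ⟦ b ℕ.* q ∣ y + + t * + q ⟧) ≡ ⟦ q ∣ y ⟧
∑-⟦∣⟧-refine b q y with + q ∣? y
... | yes (divides z y≡zq) = trans (∑-cong b (λ t _ → ⟦∣⟧-cong (cancel t) (scale t))) (∑-⟦∣⟧-window b z)
  where
  lift : ∀ t → y + + t * + q ≡ (z + + t) * + q
  lift t = trans (cong (λ w → w + + t * + q) y≡zq) (sym (ℤP.*-distribʳ-+ (+ q) z (+ t)))
  cancel : ∀ t → + (b ℕ.* q) ∣ y + + t * + q → + b ∣ z + + t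
  cancel t d = ℤ∣.*-cancelʳ-∣ (+ q) (subst₂ _∣_ (ℤP.pos-* b q) (lift t) d)
  scale : ∀ t → + b ∣ z + + t → + (b ℕ.* q) ∣ y + + t * + q
  scale t d = subst₂ _∣_ (sym (ℤP.pos-* b q)) (sym (lift t)) (ℤ∣.*-monoˡ-∣ (+ q) d)
... | no q∤y = ∑-zero b (λ t _ → ⟦∣⟧-no (λ d → q∤y (ℤ∣.∣m+n∣n⇒∣m (ℤ∣.∣-trans q∣bq d) (divides (+ t) refl))))
  where
  q∣bq : + q ∣ + (b ℕ.* q)
  q∣bq = divides (+ b) (ℤP.pos-* b q)

x+y-v≡x-v+y : ∀ x y v → x + y - v ≡ (x - v) + y
x+y-v≡x-v+y = ℤ-Ring.solve-∀

v+[x-v]≡x : ∀ x v → v + (x - v) ≡ x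
v+[x-v]≡x = ℤ-Ring.solve-∀

count : ℕ → (ℕ → ℤ) → ℕ → ℤ → ℕ
count q a i x = ∑ i (λ j → ⟦ q ∣ x - a j ⟧)

count-suc : ∀ q a i x → count q a (suc i) x ≡ count q a i x ℕ.+ ⟦ q ∣ x - a i ⟧
count-suc q a i x = ∑-last i (λ j → ⟦ q ∣ x - a j ⟧)

count-periodic : ∀ q a i x {y} → + q ∣ y → count q a i (x + y) ≡ count q a i x
count-periodic q a i x {y} q∣y = ∑-cong i (λ j _ → ⟦∣⟧-cong
  (λ d → ℤ∣.∣m+n∣n⇒∣m (subst (+ q ∣_) (x+y-v≡x-v+y x y (a j)) d) q∣y)
  (λ d → subst (+ q ∣_) (sym (x+y-v≡x-v+y x y (a j))) (ℤ∣.∣m∣n⇒∣m+n d q∣y)))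

count-one : ∀ a i x → count 1 a i x ≡ i
count-one a i x = trans (∑-cong i (λ j _ → ⟦∣⟧-yes (divides (x - a j) (sym (ℤP.*-identityʳ _)))))
                        (trans (∑-const i 1) (ℕP.*-identityʳ i))

count-antitone : ∀ {q r} a i x → + q ∣ + r → count r a i x ≤ count q a i x
count-antitone a i x q∣r = ∑-mono-≤ i (λ j _ → ⟦∣⟧-mono (ℤ∣.∣-trans q∣r))

∑-count-classes : ∀ q .{{_ : NonZero q}} a i x → ∑ q (λ t → count q a i (x + + t)) ≡ i
∑-count-classes q a i x = begin
  ∑ q (λ t → count q a i (x + + t))           ≡⟨ ∑-comm q i (λ t j → ⟦ q ∣ x + + t - a j ⟧) ⟩
  ∑ i (λ j → ∑ q (λ t → ⟦ q ∣ x + + t - a j ⟧)) ≡⟨ ∑-cong i (λ j _ → one-class j) ⟩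
  ∑ i (λ _ → 1)                               ≡⟨ trans (∑-const i 1) (ℕP.*-identityʳ i) ⟩
  i                                           ∎
  where
  open ≡-Reasoning
  one-class : ∀ j → ∑ q (λ t → ⟦ q ∣ x + + t - a j ⟧) ≡ 1
  one-class j = trans (∑-cong q (λ t _ → cong ⟦ q ∣_⟧ (x+y-v≡x-v+y x (+ t) (a j)))) (∑-⟦∣⟧-window q (x - a j))

∑-count-refine : ∀ b q .{{_ : NonZero b}} .{{_ : NonZero q}} a i x →
                 ∑ b (λ t → count (b ℕ.* q) a i (x + + t * + q)) ≡ count q a i x
∑-count-refine b q a i x = begin
  ∑ b (λ t → count (b ℕ.* q) a i (x + + t * + q))
    ≡⟨ ∑-comm b i (λ t j → ⟦ b ℕ.* q ∣ x + + t * + q - a j ⟧) ⟩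
  ∑ i (λ j → ∑ b (λ t → ⟦ b ℕ.* q ∣ x + + t * + q - a j ⟧))
    ≡⟨ ∑-cong i (λ j _ → trans (∑-cong b (λ t _ → cong ⟦ b ℕ.* q ∣_⟧ (x+y-v≡x-v+y x (+ t * + q) (a j))))
                               (∑-⟦∣⟧-refine b q (x - a j))) ⟩
  count q a i x ∎
  where open ≡-Reasoning

Balanced : ℕ → (ℕ → ℤ) → ℕ → Set
Balanced q a i = ∀ x y → count q a i x ≤ suc (count q a i y)

balanced-zero : ∀ q a → Balanced q a 0
balanced-zero q a x y = z≤n

balanced-suc : ∀ {q a i} → Balanced q a i → (∀ y → count q a i (a i) ≤ count q a i y) →
               Balanced q a (suc i)
balanced-suc {q} {a} {i} bal aᵢ-least x y = ℕP.≤-trans x-bound (s≤s y-grows)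
  where
  open ℕP.≤-Reasoning
  y-grows : count q a i y ≤ count q a (suc i) y
  y-grows = ℕP.≤-trans (ℕP.m≤m+n _ _) (ℕP.≤-reflexive (sym (count-suc q a i y)))
  same-class : + q ∣ x - a i → count q a i x ≡ count q a i (a i)
  same-class q∣x-aᵢ = trans (cong (count q a i) (sym (v+[x-v]≡x x (a i)))) (count-periodic q a i (a i) q∣x-aᵢ)
  x-bound : count q a (suc i) x ≤ suc (count q a i y)
  x-bound with + q ∣? (x - a i)
  ... | yes q∣x-aᵢ = begin
    count q a (suc i) x               ≡⟨ count-suc q a i x ⟩
    count q a i x ℕ.+ ⟦ q ∣ x - a i ⟧  ≡⟨ cong (count q a i x ℕ.+_) (⟦∣⟧-yes q∣x-aᵢ) ⟩
    count q a i x ℕ.+ 1               ≡⟨ cong (ℕ._+ 1) (same-class q∣x-aᵢ) ⟩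
    count q a i (a i) ℕ.+ 1           ≤⟨ ℕP.+-monoˡ-≤ 1 (aᵢ-least y) ⟩
    count q a i y ℕ.+ 1               ≡⟨ ℕP.+-comm _ 1 ⟩
    suc (count q a i y)               ∎
  ... | no q∤x-aᵢ = begin
    count q a (suc i) x               ≡⟨ count-suc q a i x ⟩
    count q a i x ℕ.+ ⟦ q ∣ x - a i ⟧  ≡⟨ cong (count q a i x ℕ.+_) (⟦∣⟧-no q∤x-aᵢ) ⟩
    count q a i x ℕ.+ 0               ≡⟨ ℕP.+-identityʳ _ ⟩
    count q a i x                     ≤⟨ bal x y ⟩
    suc (count q a i y)               ∎

balanced⇒quotient≤count : ∀ {q a i} .{{_ : NonZero q}} → Balanced q a i → ∀ y → i / q ≤ count q a i y
balanced⇒quotient≤count {q} {a} {i} bal y = ℕP.≤-pred (ℕ/.m<n*o⇒m/o<n i<[1+c]q)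
  where
  c = count q a i y
  i<q[1+c] : i < q ℕ.* suc c
  i<q[1+c] = subst (_< q ℕ.* suc c) (∑-count-classes q a i y)
    (∑-<-deficient q (λ t → count q a i (y + + t)) (λ t _ → bal (y + + t) y) (ℕ.>-nonZero⁻¹ q)
      (ℕP.≤-reflexive (cong (suc ∘ count q a i) (ℤP.+-identityʳ y))))
  i<[1+c]q : i < suc c ℕ.* q
  i<[1+c]q = subst (i <_) (ℕP.*-comm q (suc c)) i<q[1+c]

ord[0]≡∞ : ∀ b → ord b (+ 0) ≡ ∞
ord[0]≡∞ zero          = refl
ord[0]≡∞ (suc zero)    = refl
ord[0]≡∞ (suc (suc _)) = refl

+∞-zeroʳ : ∀ z → z +∞ ∞ ≡ ∞
+∞-zeroʳ (fin _) = refl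
+∞-zeroʳ ∞       = refl

∞≰fin : ∀ {n} → ¬ (∞ ≤∞ fin n)
∞≰fin ()

sumOrd-∞ : ∀ b a {i x j} → j < i → x ≡ a j → sumOrd b a i x ≡ ∞
sumOrd-∞ b a {suc i} {x} {j} j<1+i x≡aⱼ with j ℕP.≟ i
... | yes refl = trans (cong (sumOrd b a j x +∞_) (trans (cong (ord b) (ℤP.i≡j⇒i-j≡0 x≡aⱼ)) (ord[0]≡∞ b)))
                       (+∞-zeroʳ (sumOrd b a j x))
... | no j≢i rewrite sumOrd-∞ b a (ℕP.≤∧≢⇒< (ℕ.s≤s⁻¹ j<1+i) j≢i) x≡aⱼ = refl

m*n≤o⇒m≤o/n : ∀ {m o} n .{{_ : NonZero n}} → m ℕ.* n ≤ o → m ≤ o / n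
m*n≤o⇒m≤o/n {m} {o} n mn≤o = subst (_≤ o / n) (ℕ/.m*n/n≡m m n) (ℕ/./-monoˡ-≤ n mn≤o)

module Radix (c : ℕ) where
  b : ℕ
  b = suc (suc c)

  open ℕP

  b^≢0 : ∀ e → NonZero (b ^ e)
  b^≢0 e = m^n≢0 b e

  infixl 7 _/b^_
  _/b^_ : ℕ → ℕ → ℕ
  k /b^ e = (k / b ^ e) {{b^≢0 e}}

  n<b^n : ∀ n → n < b ^ n
  n<b^n zero    = z<s
  n<b^n (suc n) = begin-strict
    suc n                          <⟨ s<s (n<b^n n) ⟩
    1 ℕ.+ b ^ n                    ≤⟨ +-monoˡ-≤ (b ^ n) (m^n>0 b n) ⟩
    b ^ n ℕ.+ b ^ n                ≤⟨ +-monoʳ-≤ (b ^ n) (m≤m+n (b ^ n) _) ⟩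
    b ^ suc n                      ∎
    where open ≤-Reasoning

  /b^-zero : ∀ k → k /b^ 0 ≡ k
  /b^-zero = ℕ/.n/1≡n

  /b^-suc : ∀ k e → k /b^ suc e ≡ (k / b) /b^ e
  /b^-suc k e = sym (ℕ/.m/n/o≡m/[n*o] k b (b ^ e) {{_}} {{b^≢0 e}} {{b^≢0 (suc e)}})

  /b^-sucʳ : ∀ k e → k /b^ suc e ≡ (k /b^ e) / b
  /b^-sucʳ k e = sym (trans (ℕ/.m/n/o≡m/[n*o] k (b ^ e) b {{b^≢0 e}} {{_}} {{m*n≢0 (b ^ e) b {{b^≢0 e}}}})
                            (ℕ/./-congʳ {{m*n≢0 (b ^ e) b {{b^≢0 e}}}} {{b^≢0 (suc e)}} (*-comm (b ^ e) b)))

  /b^-small : ∀ k e → k < b ^ e → k /b^ e ≡ 0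
  /b^-small k e = ℕ/.m<n⇒m/n≡0 {k} {b ^ e} {{b^≢0 e}}

  /b^-vanish : ∀ k e → k ≤ e → k /b^ e ≡ 0
  /b^-vanish k e k≤e = /b^-small k e (≤-<-trans k≤e (n<b^n e))

  ≤/b^ : ∀ {m k} e → m ℕ.* b ^ e ≤ k → m ≤ k /b^ e
  ≤/b^ e = m*n≤o⇒m≤o/n (b ^ e) {{b^≢0 e}}

  /b^*b^≤ : ∀ k e → k /b^ e ℕ.* b ^ e ≤ k
  /b^*b^≤ k e = ℕ/.m/n*n≤m k (b ^ e) {{b^≢0 e}}

  /b^-superadditive : ∀ k l e → k /b^ e ℕ.+ l /b^ e ≤ (k ℕ.+ l) /b^ e
  /b^-superadditive k l e = ≤/b^ e (begin
    (k /b^ e ℕ.+ l /b^ e) ℕ.* b ^ e          ≡⟨ *-distribʳ-+ (b ^ e) (k /b^ e) (l /b^ e) ⟩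
    k /b^ e ℕ.* b ^ e ℕ.+ l /b^ e ℕ.* b ^ e  ≤⟨ +-mono-≤ (/b^*b^≤ k e) (/b^*b^≤ l e) ⟩
    k ℕ.+ l                                  ∎)
    where open ≤-Reasoning

  legendre : ℕ → ℕ
  legendre k = ∑ k (λ e → k /b^ suc e)

  legendre-extend : ∀ {k N} → k ≤ N → ∑ N (λ e → k /b^ suc e) ≡ legendre k
  legendre-extend {k} k≤N = ∑-extend (λ e → k /b^ suc e) k≤N (λ e k≤e _ → /b^-vanish k (suc e) (m≤n⇒m≤1+n k≤e))

  legendre-small : ∀ {k} → k < b → legendre k ≡ 0
  legendre-small {k} k<b = ∑-zero k (λ e _ → /b^-small k (suc e) (<-≤-trans k<b (m≤m*n b (b ^ e) {{b^≢0 e}})))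

  b^∣b^ : ∀ {e f} → e ≤ f → + (b ^ e) ∣ + (b ^ f)
  b^∣b^ {e} {f} e≤f = ∣ᵤ⇒∣ {+ (b ^ e)} {+ (b ^ f)}
    (ℕ∣.divides (b ^ (f ∸ e)) (trans (cong (b ^_) (sym (m∸n+n≡m e≤f))) (^-distribˡ-+-* b (f ∸ e) e)))

  largestPow-∑ : ∀ y k → largestPow b ∣ y ∣ k ≡ ∑ k (λ e → ⟦ b ^ suc e ∣ y ⟧)
  largestPow-∑ y zero    = refl
  largestPow-∑ y (suc k) with (b ^ suc k) ∣ₙ? ∣ y ∣
  ... | yes bᵏ⁺¹∣y = sym (begin
    ∑ (suc k) (λ e → ⟦ b ^ suc e ∣ y ⟧)
      ≡⟨ ∑-cong (suc k) (λ e e<1+k → ⟦∣⟧-yes {b ^ suc e} {y} (ℤ∣.∣-trans (b^∣b^ (s≤s (ℕ.s≤s⁻¹ e<1+k))) (∣ᵤ⇒∣ bᵏ⁺¹∣y))) ⟩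
    ∑ (suc k) (λ _ → 1)                           ≡⟨ trans (∑-const (suc k) 1) (*-identityʳ (suc k)) ⟩
    suc k                                         ∎)
    where open ≡-Reasoning
  ... | no bᵏ⁺¹∤y = begin
    largestPow b ∣ y ∣ k                           ≡⟨ largestPow-∑ y k ⟩
    ∑ k (λ e → ⟦ b ^ suc e ∣ y ⟧)                   ≡⟨ sym (+-identityʳ _) ⟩
    ∑ k (λ e → ⟦ b ^ suc e ∣ y ⟧) ℕ.+ 0
      ≡⟨ cong (∑ k (λ e → ⟦ b ^ suc e ∣ y ⟧) ℕ.+_) (sym (⟦∣⟧-no {b ^ suc k} {y} (bᵏ⁺¹∤y ∘ ∣⇒∣ᵤ))) ⟩
    ∑ k (λ e → ⟦ b ^ suc e ∣ y ⟧) ℕ.+ ⟦ b ^ suc k ∣ y ⟧ ≡⟨ sym (∑-last k (λ e → ⟦ b ^ suc e ∣ y ⟧)) ⟩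
    ∑ (suc k) (λ e → ⟦ b ^ suc e ∣ y ⟧)             ∎
    where open ≡-Reasoning

  ⟦b^∣⟧-vanish : ∀ {y e} → y ≢ + 0 → ∣ y ∣ ≤ e → ⟦ b ^ suc e ∣ y ⟧ ≡ 0
  ⟦b^∣⟧-vanish {y} {e} y≢0 ∣y∣≤e = ⟦∣⟧-no (λ d → <⇒≱ ∣y∣<bᵉ⁺¹ (ℕ∣.∣⇒≤ {{∣y∣≢0}} (∣⇒∣ᵤ d)))
    where
    ∣y∣<bᵉ⁺¹ : ∣ y ∣ < b ^ suc e
    ∣y∣<bᵉ⁺¹ = ≤-<-trans ∣y∣≤e (<-≤-trans (n<b^n e) (^-monoʳ-≤ b (n≤1+n e)))
    ∣y∣≢0 : NonZero ∣ y ∣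
    ∣y∣≢0 = ℕ.≢-nonZero (y≢0 ∘ ℤP.∣i∣≡0⇒i≡0)

  largestPow-∑-extend : ∀ {y N} → y ≢ + 0 → ∣ y ∣ ≤ N →
                        largestPow b ∣ y ∣ ∣ y ∣ ≡ ∑ N (λ e → ⟦ b ^ suc e ∣ y ⟧)
  largestPow-∑-extend {y} y≢0 ∣y∣≤N =
    trans (largestPow-∑ y ∣ y ∣) (sym (∑-extend _ ∣y∣≤N (λ e ∣y∣≤e _ → ⟦b^∣⟧-vanish y≢0 ∣y∣≤e)))

  ord-∑ : ∀ {y N} → y ≢ + 0 → ∣ y ∣ ≤ N → ord b y ≡ fin (∑ N (λ e → ⟦ b ^ suc e ∣ y ⟧))
  ord-∑ {+ zero}       y≢0 _     = ⊥-elim (y≢0 refl)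
  ord-∑ {y@(+ suc _)}  y≢0 ∣y∣≤N = cong fin (largestPow-∑-extend y≢0 ∣y∣≤N)
  ord-∑ {y@(-[1+ _ ])} y≢0 ∣y∣≤N = cong fin (largestPow-∑-extend y≢0 ∣y∣≤N)

  sumOrd-∑ : ∀ a {i x N} → (∀ j → j < i → x - a j ≢ + 0) → (∀ j → j < i → ∣ x - a j ∣ ≤ N) →
             sumOrd b a i x ≡ fin (∑ N (λ e → count (b ^ suc e) a i x))
  sumOrd-∑ a {i} {x} {N} x≢aⱼ ∣x-aⱼ∣≤N =
    trans (by-j i x≢aⱼ ∣x-aⱼ∣≤N) (cong fin (∑-comm i N (λ j e → ⟦ b ^ suc e ∣ x - a j ⟧)))
    where
    by-j : ∀ i → (∀ j → j < i → x - a j ≢ + 0) → (∀ j → j < i → ∣ x - a j ∣ ≤ N) →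
           sumOrd b a i x ≡ fin (∑ i (λ j → ∑ N (λ e → ⟦ b ^ suc e ∣ x - a j ⟧)))
    by-j zero    _       _      = refl
    by-j (suc i) x≢aⱼ ∣x-aⱼ∣≤N = begin
      sumOrd b a i x +∞ ord b (x - a i)
        ≡⟨ cong₂ _+∞_ (by-j i (λ j j<i → x≢aⱼ j (m<n⇒m<1+n j<i)) (λ j j<i → ∣x-aⱼ∣≤N j (m<n⇒m<1+n j<i)))
                      (ord-∑ (x≢aⱼ i ≤-refl) (∣x-aⱼ∣≤N i ≤-refl)) ⟩
      fin (∑ i (λ j → ∑ N (λ e → ⟦ b ^ suc e ∣ x - a j ⟧)) ℕ.+ ∑ N (λ e → ⟦ b ^ suc e ∣ x - a i ⟧))
        ≡⟨ cong fin (sym (∑-last i (λ j → ∑ N (λ e → ⟦ b ^ suc e ∣ x - a j ⟧)))) ⟩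
      fin (∑ (suc i) (λ j → ∑ N (λ e → ⟦ b ^ suc e ∣ x - a j ⟧))) ∎
      where open ≡-Reasoning

  module _ (a : ℕ → ℤ) where

    AllBalanced : ℕ → Set
    AllBalanced i = ∀ e → Balanced (b ^ e) a i

    InLeastClasses : ℕ → ℤ → Set
    InLeastClasses i x = ∀ e → count (b ^ e) a i x ≡ i /b^ e

    least-from-prefix : ∀ {i x} E → i < b ^ E → (∀ e → e ≤ E → count (b ^ e) a i x ≡ i /b^ e) →
                        InLeastClasses i x
    least-from-prefix {i} {x} E i<bᴱ prefix e with e ≤? E
    ... | yes e≤E = prefix e e≤E
    ... | no  e≰E = trans (n≤0⇒n≡0 count≤0) (sym (/b^-small i e (<-≤-trans i<bᴱ (^-monoʳ-≤ b E≤e))))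
      where
      E≤e = <⇒≤ (≰⇒> e≰E)
      count≤0 : count (b ^ e) a i x ≤ 0
      count≤0 = ≤-trans (count-antitone a i x (b^∣b^ E≤e)) (≤-reflexive (trans (prefix E ≤-refl) (/b^-small i E i<bᴱ)))

    -- Of the b lifts of x modulo b^(E+1), one holds at most the average ⌊i/b^E⌋/b of the counts.
    ∃-prefix : ∀ {i} → AllBalanced i → ∀ E → Σ ℤ λ x → ∀ e → e ≤ E → count (b ^ e) a i x ≡ i /b^ e
    ∃-prefix {i} bal zero = + 0 , λ { .zero z≤n → trans (count-one a i (+ 0)) (sym (/b^-zero i)) }
    ∃-prefix {i} bal (suc E) with ∃-prefix bal E
    ... | x , prefix with ∃-term≤average b (λ t → count (b ^ suc E) a i (x + + t * + (b ^ E))) (s≤s z≤n)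
    ...   | t , _ , avg = x′ , prefix′
      where
      x′ = x + + t * + (b ^ E)
      refine : ∑ b (λ t → count (b ^ suc E) a i (x + + t * + (b ^ E))) ≡ count (b ^ E) a i x
      refine = ∑-count-refine b (b ^ E) {{_}} {{b^≢0 E}} a i x
      upper : count (b ^ suc E) a i x′ ≤ i /b^ suc E
      upper = begin
        count (b ^ suc E) a i x′  ≤⟨ m*n≤o⇒m≤o/n b (begin
          count (b ^ suc E) a i x′ ℕ.* b  ≡⟨ *-comm (count (b ^ suc E) a i x′) b ⟩
          b ℕ.* count (b ^ suc E) a i x′  ≤⟨ avg ⟩
          ∑ b (λ t → count (b ^ suc E) a i (x + + t * + (b ^ E)))  ≡⟨ refine ⟩
          count (b ^ E) a i x             ≡⟨ prefix E ≤-refl ⟩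
          i /b^ E                         ∎) ⟩
        (i /b^ E) / b             ≡⟨ sym (/b^-sucʳ i E) ⟩
        i /b^ suc E               ∎
        where open ≤-Reasoning
      top : count (b ^ suc E) a i x′ ≡ i /b^ suc E
      top = ≤-antisym upper (balanced⇒quotient≤count {{b^≢0 (suc E)}} (bal (suc E)) x′)
      below : ∀ e → e ≤ E → count (b ^ e) a i x′ ≡ i /b^ e
      below e e≤E = trans (count-periodic (b ^ e) a i x (ℤ∣.∣-trans (b^∣b^ e≤E) (divides (+ t) refl))) (prefix e e≤E)
      prefix′ : ∀ e → e ≤ suc E → count (b ^ e) a i x′ ≡ i /b^ e
      prefix′ e e≤1+E with e ≟ suc E
      ... | yes refl = top
      ... | no  e≢1+E = below e (ℕ.s≤s⁻¹ (≤∧≢⇒< e≤1+E e≢1+E))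

    ∃-least : ∀ {i} → AllBalanced i → Σ ℤ (InLeastClasses i)
    ∃-least {i} bal with ∃-prefix bal i
    ... | x , prefix = x , least-from-prefix {i} {x} i (n<b^n i) prefix

    least-fresh : ∀ {i x} → InLeastClasses i x → ∀ j → j < i → x - a j ≢ + 0
    least-fresh {i} {x} least j j<i x-aⱼ≡0 = n≮0 (begin
      1                          ≡⟨ sym (⟦∣⟧-yes {b ^ i} {x - a j} (subst (+ (b ^ i) ∣_) (sym x-aⱼ≡0) (divides (+ 0) refl))) ⟩
      ⟦ b ^ i ∣ x - a j ⟧        ≤⟨ term≤∑ i (λ j → ⟦ b ^ i ∣ x - a j ⟧) j<i ⟩
      count (b ^ i) a i x        ≡⟨ least i ⟩
      i /b^ i                    ≡⟨ /b^-small i i (n<b^n i) ⟩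
      0                          ∎)
      where open ≤-Reasoning

    -- The summand i makes the bound at least i, so that no nonzero ⌊i/b^(e+1)⌋ is cut off.
    spread : ℕ → ℤ → ℕ
    spread i x = i ℕ.+ ∑ i (λ j → ∣ x - a j ∣)

    ≤spread : ∀ {i} x j → j < i → ∣ x - a j ∣ ≤ spread i x
    ≤spread {i} x j j<i = ≤-trans (term≤∑ i (λ j → ∣ x - a j ∣) j<i) (m≤n+m _ i)

    least⇒sumOrd : ∀ {i x} → InLeastClasses i x → sumOrd b a i x ≡ fin (legendre i)
    least⇒sumOrd {i} {x} least = begin
      sumOrd b a i x                                       ≡⟨ sumOrd-∑ a {i} {x} (least-fresh {i} {x} least) (≤spread x) ⟩
      fin (∑ (spread i x) (λ e → count (b ^ suc e) a i x))  ≡⟨ cong fin (∑-cong (spread i x) (λ e _ → least (suc e))) ⟩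
      fin (∑ (spread i x) (λ e → i /b^ suc e))              ≡⟨ cong fin (legendre-extend (m≤m+n i _)) ⟩
      fin (legendre i)                                     ∎
      where open ≡-Reasoning

    module _ (ordering : IsBOrdering b a) where

      -- a_i does no worse than a point all of whose counts are minimal, and none of its own counts
      -- is below the minimum; so all of them are minimal.
      ordering⇒least : ∀ {i} → AllBalanced i → InLeastClasses i (a i)
      ordering⇒least {zero}    _   e = sym (ℕ/.0/n≡0 (b ^ e) {{b^≢0 e}})
      ordering⇒least {i@(suc _)} bal with ∃-least bal
      ... | x , least = least-from-prefix {i} {a i} N (≤-<-trans (m≤m+n i _) (n<b^n N)) prefix
        where
        N = spread i (a i)
        aᵢ≤x : sumOrd b a i (a i) ≤∞ fin (legendre i)
        aᵢ≤x = subst (sumOrd b a i (a i) ≤∞_) (least⇒sumOrd {i} {x} least) (ordering i (s≤s z≤n) x)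
        fresh : ∀ j → j < i → a i - a j ≢ + 0
        fresh j j<i aᵢ-aⱼ≡0 =
          ∞≰fin (subst (_≤∞ fin (legendre i)) (sumOrd-∞ b a j<i (ℤP.i-j≡0⇒i≡j (a i) (a j) aᵢ-aⱼ≡0)) aᵢ≤x)
        ∑count≤legendre : ∑ N (λ e → count (b ^ suc e) a i (a i)) ≤ ∑ N (λ e → i /b^ suc e)
        ∑count≤legendre with subst (_≤∞ fin (legendre i)) (sumOrd-∑ a {i} {a i} fresh (≤spread (a i))) aᵢ≤x
        ... | fin≤fin le = ≤-trans le (≤-reflexive (sym (legendre-extend (m≤m+n i _))))
        tight : ∀ e → e < N → i /b^ suc e ≡ count (b ^ suc e) a i (a i)
        tight = ∑-mono-≤-tight N (λ e _ → balanced⇒quotient≤count {b ^ suc e} {a} {i} {{b^≢0 (suc e)}} (bal (suc e)) (a i))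
                                 ∑count≤legendre
        prefix : ∀ e → e ≤ N → count (b ^ e) a i (a i) ≡ i /b^ e
        prefix zero    _     = trans (count-one a i (a i)) (sym (/b^-zero i))
        prefix (suc e) 1+e≤N = sym (tight e 1+e≤N)

      allBalanced : ∀ i → AllBalanced i
      allBalanced zero    e = balanced-zero (b ^ e) a
      allBalanced (suc i) e = balanced-suc {b ^ e} {a} {i} (bal e) (λ y → subst (_≤ count (b ^ e) a i y) (sym (ordering⇒least bal e))
                                                               (balanced⇒quotient≤count {b ^ e} {a} {i} {{b^≢0 e}} (bal e) y))
        where bal = allBalanced i

      α≡legendre : ∀ i → α b a i ≡ fin (legendre i)
      α≡legendre i = least⇒sumOrd {i} {a i} (ordering⇒least (allBalanced i))

  legendre-superadditive : ∀ k l → legendre k ℕ.+ legendre l ≤ legendre (k ℕ.+ l)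
  legendre-superadditive k l = begin
    legendre k ℕ.+ legendre l
      ≡⟨ sym (cong₂ ℕ._+_ (legendre-extend (m≤m+n k l)) (legendre-extend (m≤n+m l k))) ⟩
    ∑ (k ℕ.+ l) (λ e → k /b^ suc e) ℕ.+ ∑ (k ℕ.+ l) (λ e → l /b^ suc e)
      ≡⟨ sym (∑-distrib-+ (k ℕ.+ l) _ _) ⟩
    ∑ (k ℕ.+ l) (λ e → k /b^ suc e ℕ.+ l /b^ suc e)
      ≤⟨ ∑-mono-≤ (k ℕ.+ l) (λ e _ → /b^-superadditive k l (suc e)) ⟩
    ∑ (k ℕ.+ l) (λ e → (k ℕ.+ l) /b^ suc e)
      ≡⟨⟩
    legendre (k ℕ.+ l) ∎
    where open ≤-Reasoning

  legendre-superadditive-∸ : ∀ {n k} → k ≤ n → legendre k ℕ.+ legendre (n ∸ k) ≤ legendre n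
  legendre-superadditive-∸ {n} {k} k≤n = subst (λ m → legendre k ℕ.+ legendre (n ∸ k) ≤ legendre m) (m+[n∸m]≡n k≤n)
                                                (legendre-superadditive k (n ∸ k))

  legendre-digitSum : ∀ k → suc c ℕ.* legendre k ℕ.+ digitSum b k ≡ k
  legendre-digitSum k = go k k ≤-refl
    where
    open ≡-Reasoning

    shift : ∀ f k → ∑ (suc f) (λ e → k /b^ suc e) ≡ k / b ℕ.+ ∑ f (λ e → (k / b) /b^ suc e)
    shift f k = cong₂ ℕ._+_ (trans (/b^-suc k 0) (/b^-zero (k / b))) (∑-cong f (λ e _ → /b^-suc k (suc e)))

    regroup : ∀ q r L d → suc c ℕ.* (q ℕ.+ L) ℕ.+ (r ℕ.+ d) ≡ (suc c ℕ.* L ℕ.+ d) ℕ.+ (r ℕ.+ q ℕ.* suc c)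
    regroup = ℕ-Ring.solve-∀

    merge : ∀ q r → q ℕ.+ (r ℕ.+ q ℕ.* suc c) ≡ r ℕ.+ q ℕ.* b
    merge = ℕ-Ring.solve-∀

    quotient≤ : ∀ {k f} → k ≤ suc f → k / b ≤ f
    quotient≤ {zero}  _        = z≤n
    quotient≤ {suc k} k≤1+f = ≤-pred (<-≤-trans (ℕ/.m/n<m (suc k) b (s≤s (s≤s z≤n))) k≤1+f)

    go : ∀ f k → k ≤ f → suc c ℕ.* ∑ f (λ e → k /b^ suc e) ℕ.+ digitSumAux b f k ≡ k
    go zero    .zero z≤n   = cong (ℕ._+ 0) (*-zeroʳ (suc c))
    go (suc f) k     k≤1+f = begin
      suc c ℕ.* ∑ (suc f) (λ e → k /b^ suc e) ℕ.+ (k % b ℕ.+ digitSumAux b f (k / b))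
        ≡⟨ cong (λ L → suc c ℕ.* L ℕ.+ (k % b ℕ.+ digitSumAux b f (k / b))) (shift f k) ⟩
      suc c ℕ.* (k / b ℕ.+ L′) ℕ.+ (k % b ℕ.+ digitSumAux b f (k / b))
        ≡⟨ regroup (k / b) (k % b) L′ (digitSumAux b f (k / b)) ⟩
      (suc c ℕ.* L′ ℕ.+ digitSumAux b f (k / b)) ℕ.+ (k % b ℕ.+ k / b ℕ.* suc c)
        ≡⟨ cong (ℕ._+ (k % b ℕ.+ k / b ℕ.* suc c)) (go f (k / b) (quotient≤ k≤1+f)) ⟩
      k / b ℕ.+ (k % b ℕ.+ k / b ℕ.* suc c)
        ≡⟨ merge (k / b) (k % b) ⟩
      k % b ℕ.+ k / b ℕ.* b
        ≡⟨ sym (ℕ/.m≡m%n+[m/n]*n k b) ⟩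
      k ∎
      where L′ = ∑ f (λ e → (k / b) /b^ suc e)

  legendre-binomial-digitSum : ∀ {n k} → k ≤ n →
    suc c ℕ.* (legendre n ∸ (legendre k ℕ.+ legendre (n ∸ k))) ℕ.+ digitSum b n ≡ digitSum b k ℕ.+ digitSum b (n ∸ k)
  legendre-binomial-digitSum {n} {k} k≤n = +-cancelʳ-≡ T _ _ (begin
    (suc c ℕ.* x ℕ.+ digitSum b n) ℕ.+ T                   ≡⟨ regroup (suc c) x (digitSum b n) (legendre k) (legendre (n ∸ k)) ⟩
    suc c ℕ.* (legendre k ℕ.+ legendre (n ∸ k) ℕ.+ x) ℕ.+ digitSum b n
      ≡⟨ cong (λ L → suc c ℕ.* L ℕ.+ digitSum b n) (m+[n∸m]≡n (legendre-superadditive-∸ k≤n)) ⟩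
    suc c ℕ.* legendre n ℕ.+ digitSum b n                   ≡⟨ legendre-digitSum n ⟩
    n                                                     ≡⟨ sym (m+[n∸m]≡n k≤n) ⟩
    k ℕ.+ (n ∸ k)                                         ≡⟨ sym (cong₂ ℕ._+_ (legendre-digitSum k) (legendre-digitSum (n ∸ k))) ⟩
    (suc c ℕ.* legendre k ℕ.+ digitSum b k) ℕ.+ (suc c ℕ.* legendre (n ∸ k) ℕ.+ digitSum b (n ∸ k))
      ≡⟨ swap (suc c) (legendre k) (legendre (n ∸ k)) (digitSum b k) (digitSum b (n ∸ k)) ⟩
    (digitSum b k ℕ.+ digitSum b (n ∸ k)) ℕ.+ T             ∎)
    where
    open ≡-Reasoning
    x = legendre n ∸ (legendre k ℕ.+ legendre (n ∸ k))
    T = suc c ℕ.* legendre k ℕ.+ suc c ℕ.* legendre (n ∸ k)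
    regroup : ∀ A x d L L′ → (A ℕ.* x ℕ.+ d) ℕ.+ (A ℕ.* L ℕ.+ A ℕ.* L′) ≡ A ℕ.* (L ℕ.+ L′ ℕ.+ x) ℕ.+ d
    regroup = ℕ-Ring.solve-∀
    swap : ∀ A L L′ d d′ → (A ℕ.* L ℕ.+ d) ℕ.+ (A ℕ.* L′ ℕ.+ d′) ≡ (d ℕ.+ d′) ℕ.+ (A ℕ.* L ℕ.+ A ℕ.* L′)
    swap = ℕ-Ring.solve-∀

ord₀-nonzero : ∀ {y} → y ≢ + 0 → ord 0 y ≡ fin 0
ord₀-nonzero {+ zero}    y≢0 = ⊥-elim (y≢0 refl)
ord₀-nonzero {+ suc _}   _   = refl
ord₀-nonzero { -[1+ _ ]} _   = refl

sumOrd₀-fresh : ∀ (a : ℕ → ℤ) {i x} → (∀ j → j < i → x - a j ≢ + 0) → sumOrd 0 a i x ≡ fin 0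
sumOrd₀-fresh a {zero}  _      = refl
sumOrd₀-fresh a {suc i} x≢aⱼ =
  cong₂ _+∞_ (sumOrd₀-fresh a (λ j j<i → x≢aⱼ j (ℕP.m<n⇒m<1+n j<i))) (ord₀-nonzero (x≢aⱼ i ℕP.≤-refl))

∃-fresh : ∀ (a : ℕ → ℤ) i → Σ ℤ λ x → ∀ j → j < i → x - a j ≢ + 0
∃-fresh a i = + suc bound , fresh
  where
  bound = ∑ i (λ j → ∣ a j ∣)
  fresh : ∀ j → j < i → + suc bound - a j ≢ + 0
  fresh j j<i x-aⱼ≡0 = ℕP.<-irrefl (sym (cong ∣_∣ (ℤP.i-j≡0⇒i≡j (+ suc bound) (a j) x-aⱼ≡0)))
                                   (s≤s (term≤∑ i (λ j → ∣ a j ∣) j<i))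

α₀≡0 : ∀ a → IsBOrdering 0 a → ∀ k → α 0 a k ≡ fin 0
α₀≡0 a ordering zero    = refl
α₀≡0 a ordering (suc k) with ∃-fresh a (suc k)
... | x , fresh = ≤∞0⇒≡0 (subst (α 0 a (suc k) ≤∞_) (sumOrd₀-fresh a fresh) (ordering (suc k) (s≤s z≤n) x))
  where
  ≤∞0⇒≡0 : ∀ {z} → z ≤∞ fin 0 → z ≡ fin 0
  ≤∞0⇒≡0 (fin≤fin z≤n) = refl

pow∞₁≡1 : ∀ z → pow∞ 1 z ≡ 1
pow∞₁≡1 (fin e) = ℕP.^-zeroˡ e
pow∞₁≡1 ∞       = refl

-- For b = 1 and k ≥ 1 the true exponent α_k(ℤ,1) is +∞, but 1^α = 1 either way.
factorialExponent : ℕ → ℕ → ℕ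
factorialExponent (suc (suc c)) k = Radix.legendre c k
factorialExponent _             _ = 0

pow∞-α : ∀ b a → IsBOrdering b a → ∀ k → pow∞ b (α b a k) ≡ b ^ factorialExponent b k
pow∞-α zero          a ordering k = cong (pow∞ 0) (α₀≡0 a ordering k)
pow∞-α (suc zero)    a ordering k = pow∞₁≡1 (α 1 a k)
pow∞-α (suc (suc c)) a ordering k = cong (pow∞ (suc (suc c))) (Radix.α≡legendre c a ordering k)

factorialExponent-vanish : ∀ {b k} → k < b → factorialExponent b k ≡ 0
factorialExponent-vanish {suc zero}    _   = refl
factorialExponent-vanish {suc (suc c)} k<b = Radix.legendre-small c k<b

factorial : ℕ → ℕ
factorial k = ∏ (suc k) (λ b → b ^ factorialExponent b k)

isFactorial : ∀ σ → (∀ b → IsBOrdering b (σ b)) → ∀ k → IsFactorial σ k (factorial k)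
isFactorial σ ordering k = suc k , vanish , product
  where
  vanish : ∀ b → suc k ≤ b → pow∞ b (α b (σ b) k) ≡ 1
  vanish b k<b = trans (pow∞-α b (σ b) (ordering b) k) (cong (b ^_) (factorialExponent-vanish k<b))
  product : prodBelow (suc k) (λ b → pow∞ b (α b (σ b) k)) ≡ factorial k
  product = trans (foldr-*-map-applyUpTo (suc k) (λ b → pow∞ b (α b (σ b) k)) id)
                  (∏-cong (suc k) (λ b _ → pow∞-α b (σ b) (ordering b) k))

factorial-extend : ∀ {k N} → k < N → factorial k ≡ ∏ N (λ b → b ^ factorialExponent b k)
factorial-extend {k} k<N = sym (∏-extend (λ b → b ^ factorialExponent b k) k<N
                                  (λ b k<b _ → cong (b ^_) (factorialExponent-vanish k<b)))

factorial-pos : ∀ k → 0 < factorial k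
factorial-pos k = ∏-pos (suc k) (λ b → b ^ factorialExponent b k) (λ b _ → pow-pos b)
  where
  pow-pos : ∀ b → 0 < b ^ factorialExponent b k
  pow-pos zero    = z<s
  pow-pos (suc b) = ℕP.m^n>0 (suc b) (factorialExponent (suc b) k)

binomialExponent : ℕ → ℕ → ℕ → ℕ
binomialExponent b n k = factorialExponent b n ∸ (factorialExponent b k ℕ.+ factorialExponent b (n ∸ k))

factorialExponent-superadditive : ∀ b {n k} → k ≤ n →
  factorialExponent b k ℕ.+ factorialExponent b (n ∸ k) ≤ factorialExponent b n
factorialExponent-superadditive zero          _   = z≤n
factorialExponent-superadditive (suc zero)    _   = z≤n
factorialExponent-superadditive (suc (suc c)) k≤n = Radix.legendre-superadditive-∸ c k≤n

factorial-binomial : ∀ {n k} → k ≤ n →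
  factorial n ≡ factorial k ℕ.* factorial (n ∸ k) ℕ.* ∏ (suc n) (λ b → b ^ binomialExponent b n k)
factorial-binomial {n} {k} k≤n = begin
  factorial n
    ≡⟨ ∏-cong (suc n) (λ b _ → cong (b ^_) (sym (ℕP.m+[n∸m]≡n (factorialExponent-superadditive b k≤n)))) ⟩
  ∏ (suc n) (λ b → b ^ (E b k ℕ.+ E b (n ∸ k) ℕ.+ binomialExponent b n k))
    ≡⟨ ∏-cong (suc n) (λ b _ → split b) ⟩
  ∏ (suc n) (λ b → b ^ E b k ℕ.* b ^ E b (n ∸ k) ℕ.* b ^ binomialExponent b n k)
    ≡⟨ ∏-distrib-* (suc n) (λ b → b ^ E b k ℕ.* b ^ E b (n ∸ k)) B ⟩
  ∏ (suc n) (λ b → b ^ E b k ℕ.* b ^ E b (n ∸ k)) ℕ.* ∏ (suc n) B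
    ≡⟨ cong (ℕ._* ∏ (suc n) B) (∏-distrib-* (suc n) (λ b → b ^ E b k) (λ b → b ^ E b (n ∸ k))) ⟩
  ∏ (suc n) (λ b → b ^ E b k) ℕ.* ∏ (suc n) (λ b → b ^ E b (n ∸ k)) ℕ.* ∏ (suc n) B
    ≡⟨ cong (ℕ._* ∏ (suc n) B) (sym (cong₂ ℕ._*_ (factorial-extend (s≤s k≤n)) (factorial-extend (s≤s (ℕP.m∸n≤m n k))))) ⟩
  factorial k ℕ.* factorial (n ∸ k) ℕ.* ∏ (suc n) (λ b → b ^ binomialExponent b n k) ∎
  where
  open ≡-Reasoning
  E = factorialExponent
  B = λ b → b ^ binomialExponent b n k
  split : ∀ b → b ^ (E b k ℕ.+ E b (n ∸ k) ℕ.+ binomialExponent b n k)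
              ≡ b ^ E b k ℕ.* b ^ E b (n ∸ k) ℕ.* b ^ binomialExponent b n k
  split b = trans (ℕP.^-distribˡ-+-* b (E b k ℕ.+ E b (n ∸ k)) (binomialExponent b n k))
                  (cong (ℕ._* B b) (ℕP.^-distribˡ-+-* b (E b k) (E b (n ∸ k))))

binomialProductExponent : ℕ → ℕ → ℕ
binomialProductExponent b n = ∑ (suc n) (binomialExponent b n)

binomialProductExponent-digitSum : ∀ c n →
  suc c ℕ.* binomialProductExponent (2 ℕ.+ c) n ℕ.+ suc n ℕ.* digitSum (2 ℕ.+ c) n
    ≡ 2 ℕ.* (S (2 ℕ.+ c) n ℕ.+ digitSum (2 ℕ.+ c) n)
binomialProductExponent-digitSum c n = begin
  suc c ℕ.* ∑ (suc n) x ℕ.+ suc n ℕ.* d n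
    ≡⟨ sym (cong₂ ℕ._+_ (∑-*ˡ (suc n) (suc c) x) (∑-const (suc n) (d n))) ⟩
  ∑ (suc n) (λ k → suc c ℕ.* x k) ℕ.+ ∑ (suc n) (λ _ → d n)
    ≡⟨ sym (∑-distrib-+ (suc n) (λ k → suc c ℕ.* x k) (λ _ → d n)) ⟩
  ∑ (suc n) (λ k → suc c ℕ.* x k ℕ.+ d n)
    ≡⟨ ∑-cong (suc n) (λ k k<1+n → Radix.legendre-binomial-digitSum c (ℕ.s≤s⁻¹ k<1+n)) ⟩
  ∑ (suc n) (λ k → d k ℕ.+ d (n ∸ k))
    ≡⟨ ∑-distrib-+ (suc n) d (λ k → d (n ∸ k)) ⟩
  ∑ (suc n) d ℕ.+ ∑ (suc n) (λ k → d (n ∸ k))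
    ≡⟨ cong (∑ (suc n) d ℕ.+_) (∑-reverse n d) ⟩
  ∑ (suc n) d ℕ.+ ∑ (suc n) d
    ≡⟨ cong (∑ (suc n) d ℕ.+_) (sym (ℕP.+-identityʳ _)) ⟩
  2 ℕ.* ∑ (suc n) d
    ≡⟨ cong (2 ℕ.*_) (trans (∑-last n d) (cong (ℕ._+ d n) (sym (foldr-+-map-applyUpTo n d id)))) ⟩
  2 ℕ.* (S (2 ℕ.+ c) n ℕ.+ d n) ∎
  where
  open ≡-Reasoning
  d = digitSum (2 ℕ.+ c)
  x = binomialExponent (2 ℕ.+ c) n

binomialProductExponent-formula : ∀ b n → 2 ≤ b → 1 ≤ n →
  + (b ∸ 1) * + binomialProductExponent b n ≡ + 2 * + S b n - + (n ∸ 1) * + digitSum b n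
binomialProductExponent-formula (suc (suc c)) n@(suc m) (s≤s (s≤s z≤n)) _ = begin
  + suc c * + ν                                   ≡⟨ sym (ℤP.pos-* (suc c) ν) ⟩
  + (suc c ℕ.* ν)                                 ≡⟨ sym (x+y-y≡x (+ (suc c ℕ.* ν)) (+ (m ℕ.* d))) ⟩
  + (suc c ℕ.* ν) + + (m ℕ.* d) - + (m ℕ.* d)     ≡⟨ cong (λ z → + z - + (m ℕ.* d)) ν-ℕ ⟩
  + (2 ℕ.* S b n) - + (m ℕ.* d)                   ≡⟨ cong₂ _-_ (ℤP.pos-* 2 (S b n)) (ℤP.pos-* m d) ⟩
  + 2 * + S b n - + m * + d                       ∎
  where
  open ≡-Reasoning
  b = suc (suc c)
  ν = binomialProductExponent b n
  d = digitSum b n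
  x+y-y≡x : ∀ x y → x + y - y ≡ x
  x+y-y≡x = ℤ-Ring.solve-∀
  regroup : ∀ A ν m d → A ℕ.* ν ℕ.+ m ℕ.* d ℕ.+ 2 ℕ.* d ≡ A ℕ.* ν ℕ.+ (2 ℕ.+ m) ℕ.* d
  regroup = ℕ-Ring.solve-∀
  ν-ℕ : suc c ℕ.* ν ℕ.+ m ℕ.* d ≡ 2 ℕ.* S b n
  ν-ℕ = ℕP.+-cancelʳ-≡ (2 ℕ.* d) _ _ (begin
    suc c ℕ.* ν ℕ.+ m ℕ.* d ℕ.+ 2 ℕ.* d  ≡⟨ regroup (suc c) ν m d ⟩
    suc c ℕ.* ν ℕ.+ suc n ℕ.* d          ≡⟨ binomialProductExponent-digitSum c n ⟩
    2 ℕ.* (S b n ℕ.+ d)                  ≡⟨ ℕP.*-distribˡ-+ 2 (S b n) d ⟩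
    2 ℕ.* S b n ℕ.+ 2 ℕ.* d              ∎)

module _ where

  ι : ℕ → ℚ
  ι m = + m ℚ./ 1

  ι-* : ∀ m n → ι (m ℕ.* n) ≡ ι m ℚ.* ι n
  ι-* m n = ℚP.toℚᵘ-injective (ℚᵘP.≃-sym (begin
    ℚ.toℚᵘ (ι m ℚ.* ι n)              ≈⟨ ℚP.toℚᵘ-homo-* (ι m) (ι n) ⟩
    ℚ.toℚᵘ (ι m) ℚᵘ.* ℚ.toℚᵘ (ι n)     ≈⟨ ℚᵘP.*-cong (toℚᵘ-ι m) (toℚᵘ-ι n) ⟩
    mkℚᵘ (+ m * + n) 0                ≈⟨ *≡* (cong (_* + 1) (sym (ℤP.pos-* m n))) ⟩
    mkℚᵘ (+ (m ℕ.* n)) 0              ≈⟨ ℚᵘP.≃-sym (toℚᵘ-ι (m ℕ.* n)) ⟩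
    ℚ.toℚᵘ (ι (m ℕ.* n))              ∎))
    where
    import Data.Rational.Unnormalised as ℚᵘ
    open ℚᵘP.≃-Reasoning
    toℚᵘ-ι : ∀ k → ℚ.toℚᵘ (ι k) ℚᵘ.≃ mkℚᵘ (+ k) 0
    toℚᵘ-ι k = ℚP.toℚᵘ-fromℚᵘ (mkℚᵘ (+ k) 0)

  divℚ-*-cancelˡ : ∀ {d} m → 0 < d → divℚ (d ℕ.* m) d ≡ ι m
  divℚ-*-cancelˡ {suc d} m _ = ℚP.fromℚᵘ-cong {mkℚᵘ (+ (suc d ℕ.* m)) d} {mkℚᵘ (+ m) 0} (*≡* cross)
    where
    cross : + (suc d ℕ.* m) * + 1 ≡ + m * + suc d
    cross = trans (ℤP.*-identityʳ _) (trans (ℤP.pos-* (suc d) m) (ℤP.*-comm (+ suc d) (+ m)))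

  open BigOperator ℚP.*-1-isCommutativeMonoid using ()
    renaming (⨁ to ∏ℚ; ⨁-cong to ∏ℚ-cong; foldr-map-applyUpTo to foldr-*ℚ-map-applyUpTo)

  ι-∏ : ∀ n g → ι (∏ n g) ≡ ∏ℚ n (ι ∘ g)
  ι-∏ zero    g = refl
  ι-∏ (suc n) g = trans (ι-* (g 0) (∏ n (g ∘ suc))) (cong (ι (g 0) ℚ.*_) (ι-∏ n (g ∘ suc)))

  prodℚ-map-ι : ∀ n (f : ℕ → ℚ) g → (∀ k → k < n → f k ≡ ι (g k)) → prodℚ (map f (upTo n)) ≡ ι (∏ n g)
  prodℚ-map-ι n f g f≡ιg = trans (foldr-*ℚ-map-applyUpTo n f id) (trans (∏ℚ-cong n f≡ιg) (sym (ι-∏ n g)))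

binomℚ-factorial : ∀ {n k} → k ≤ n → binomℚ factorial n k ≡ ι (∏ (suc n) (λ b → b ^ binomialExponent b n k))
binomℚ-factorial {n} {k} k≤n =
  trans (cong (λ m → divℚ m (factorial k ℕ.* factorial (n ∸ k))) (factorial-binomial k≤n))
        (divℚ-*-cancelˡ _ (ℕP.*-mono-≤ (factorial-pos k) (factorial-pos (n ∸ k))))

Gbar-factorial : ∀ n → Gbar factorial n ≡ ι (∏ (suc n) (λ b → b ^ binomialProductExponent b n))
Gbar-factorial n = begin
  prodℚ (map (binomℚ factorial n) (upTo (suc n)))
    ≡⟨ prodℚ-map-ι (suc n) (binomℚ factorial n) (λ k → ∏ (suc n) (λ b → b ^ binomialExponent b n k))
                   (λ k k<1+n → binomℚ-factorial (ℕ.s≤s⁻¹ k<1+n)) ⟩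
  ι (∏ (suc n) (λ k → ∏ (suc n) (λ b → b ^ binomialExponent b n k)))
    ≡⟨ cong ι (∏-comm (suc n) (suc n) (λ k b → b ^ binomialExponent b n k)) ⟩
  ι (∏ (suc n) (λ b → ∏ (suc n) (λ k → b ^ binomialExponent b n k)))
    ≡⟨ cong ι (∏-cong (suc n) (λ b _ → ∏-pow (suc n) b (binomialExponent b n))) ⟩
  ι (∏ (suc n) (λ b → b ^ binomialProductExponent b n)) ∎
  where open ≡-Reasoning

∏-binomialProductExponent-from-2 : ∀ m → ∏ (2 ℕ.+ m) (λ b → b ^ binomialProductExponent b (suc m))
                                      ≡ ∏ m (λ i → (2 ℕ.+ i) ^ binomialProductExponent (2 ℕ.+ i) (suc m))
∏-binomialProductExponent-from-2 m = begin
  0 ^ binomialProductExponent 0 (suc m) ℕ.* (1 ^ binomialProductExponent 1 (suc m) ℕ.* P)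
    ≡⟨ cong₂ (λ e e′ → 0 ^ e ℕ.* (e′ ℕ.* P)) (∑-zero (2 ℕ.+ m) (λ _ _ → refl))
                                             (ℕP.^-zeroˡ (binomialProductExponent 1 (suc m))) ⟩
  1 ℕ.* (1 ℕ.* P)
    ≡⟨ trans (ℕP.*-identityˡ _) (ℕP.*-identityˡ P) ⟩
  P ∎
  where
  open ≡-Reasoning
  P = ∏ m (λ i → (2 ℕ.+ i) ^ binomialProductExponent (2 ℕ.+ i) (suc m))

theorem7p6 : (n : ℕ) → 1 ≤ n →
             (σ : ℕ → ℕ → ℤ) → (∀ b → IsBOrdering b (σ b)) →
             Σ (ℕ → ℕ) λ fact →
               (∀ k → k ≤ n → IsFactorial σ k (fact k)) ×
               Σ (ℕ → ℤ) λ ν →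
                 (∀ b → 2 ≤ b → b ≤ n →
                    (+ (b ∸ 1)) * ν b ≡ (+ 2) * (+ S b n) - (+ (n ∸ 1)) * (+ digitSum b n)) ×
                 (Gbar fact n ≡ prodℚ (map (λ i → powℤ (2 Data.Nat.+ i) (ν (2 Data.Nat.+ i))) (upTo (n ∸ 1))))
theorem7p6 n@(suc m) 1≤n σ ordering =
  factorial , (λ k _ → isFactorial σ ordering k) ,
  ν , (λ b 2≤b _ → binomialProductExponent-formula b n 2≤b 1≤n) ,
  (begin
    Gbar factorial n                                    ≡⟨ Gbar-factorial n ⟩
    ι (∏ (suc n) (λ b → b ^ binomialProductExponent b n)) ≡⟨ cong ι (∏-binomialProductExponent-from-2 m) ⟩
    ι (∏ m (λ i → (2 ℕ.+ i) ^ binomialProductExponent (2 ℕ.+ i) n))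
      ≡⟨ sym (prodℚ-map-ι m (λ i → powℤ (2 ℕ.+ i) (ν (2 ℕ.+ i))) _ (λ _ _ → refl)) ⟩
    prodℚ (map (λ i → powℤ (2 ℕ.+ i) (ν (2 ℕ.+ i))) (upTo m)) ∎)
  where
  open ≡-Reasoning
  ν : ℕ → ℤ
  ν b = + binomialProductExponent b n
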